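{- Let $\mathcal{Q}=(N,\mathcal{M})$ be an abstract questionnaire with flag-set $F$ and skip-list $\mathcal{S}=(S_0,\ldots,S_N)$. Assume that $m_q\ge 2$ for all $q=0,\ldots,N-1$ and that $F$ is compatible with $\mathcal{S}$. Let $T$ be the FS-decision tree for $\mathcal{Q}$ with question assignment $\kappa$ and answer string assignment $\alpha$, and let $v,w$ be vertices of $T$ with $\kappa(v)=\kappa(w)=k+1$, where $\alpha(v)=a=a_0\ldots a_k$ and $\alpha(w)=b=b_0\ldots b_k$. Then $v$ and $w$ are equivalent in $T$ if and only if $F^a=F^b$ and $\mathcal{S}^a=\mathcal{S}^b$.
   Context: An abstract questionnaire is a pair $(N,\mathcal{M})$ with $N$ a positive integer and $\mathcal{M}=(m_0,\ldots,m_{N-1})$ a tuple of positive integers. Put $A_i=\{0,1,\ldots,m_i-1\}$ and $A_i^*=A_i\cup\{*\}$, where $*$ is a new symbol. For $0\le k\le \ell\le N-1$, a $(k,\ell)$-answer string is a string $a_k\ldots a_\ell$ with $a_i\in A_i^*$; $\epsilon$ is the empty string; juxtaposition is concatenation. For a $(0,i)$-answer string $c_0\ldots c_i$, "$c_0\ldots c_i*\ldots*$" denotes the $(0,N-1)$-answer string obtained by appending $N-1-i$ copies of $*$ (similarly "$*\ldots*$" for $(k+1,N-1)$-strings). A flag-set is a set $F$ of $(0,N-1)$-answer strings; a $(0,k)$-answer string $c_0\ldots c_k$ (or a vertex whose answer string it is) is flagged if $c_0\ldots c_i*\ldots*\in F$ for some $0\le i\le k$. A skip-list is an $(N+1)$-tuple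 $(S_0,\ldots,S_N)$ such that: $S_0=S_N=\emptyset$; for $1\le q\le N$, $S_q$ is a set of $(0,q-1)$-answer strings; and for each $q$ with $1 \le q\le N-1$ and each $(0,q-1)$-answer string $c$: if $c\in S_q$, then for every $j\in A_q$, $cj\notin S_{q+1}$ and $cjd\notin S_{r+1}$ for all $q+1\le r\le N-1$ and $d\in A_{q+1}^*\times\cdots\times A_r^*$; if $c\notin S_q$, then $c*\notin S_{q+1}$ and $c*d\notin S_{r+1}$ for all such $r,d$. $F$ is compatible with $\mathcal{S}$ if for every $f\in F$ there is $\ell\in\{0,\ldots,N-1\}$ with: (i) $f=f_0\ldots f_\ell*\ldots*$; (ii) for all $i\in\{0,\ldots,\ell\}$, $f_0\ldots f_{i-1}\in S_i\iff f_i=*$ (for $i=0$ the prefix is $\epsilon$); (iii) if $f_\ell\ne*$, then for some $j\in A_\ell$, $f_0\ldots f_{\ell-1}j*\ldots*\notin F$; (iv) for all $i\in\{0,\ldots,\ell-1\}$, $f_0\ldots f_i*\ldots*\notin F$. The FS-decision tree $T$ is the ordered rooted tree, with set $U$ of skipped vertices, question assignment $\kappa$ and answer string assignment $\alpha$, defined recursively: the root $r$ has $\kappa(r)=0$, $\alpha(r)=\epsilon$; a vertex $u$ with $\kappa(u)=q\le N$ lies in $U$ iff $\alpha(u)\in S_q$; if $\kappa(u)=q<N$ and $u\in U$, $u$ has exactly one child $c$, with $\kappa(c)=q+1$, $\alpha(c)=\alpha(u)*$; if $\kappa(u)=q<N$ and $u\notin U$, $u$ has exactly $m_q$ children, the $j$-th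 ($j\in A_q$) child $c$ having $\kappa(c)=q+1$, $\alpha(c)=\alpha(u)j$; vertices with $\kappa=N$ have no children. $T_v$ denotes the subtree rooted at $v$ ($v$ and all its descendants). Two vertices $v,w$ with $\kappa(v)=\kappa(w)=p$ are equivalent in $T$ if there is a bijection $\Phi:V(T_v)\to V(T_w)$ such that for every $u\in V(T_v)$: (a) if $\alpha(u)=\alpha(v)x$, where $x=\epsilon$ or $x$ is a $(p,\kappa(u)-1)$-answer string, then $\alpha(\Phi(u))=\alpha(w)x$; and (b) $\alpha(u)$ is flagged iff $\alpha(\Phi(u))$ is flagged. For a $(0,k)$-answer string $a=a_0\ldots a_k$: the local flag-set $F^a$ is $\{*\ldots*\}$ (the single $(k+1,N-1)$-answer string consisting of $*$'s) if $a_0\ldots a_i*\ldots*\in F$ for some $i\le k$, and otherwise $F^a=\{d\in A_{k+1}^*\times\cdots\times A_{N-1}^*: ad\in F\}$. The local skip-list is $\mathcal{S}^a=(S^a_{k+1},\ldots,S^a_N)$ with $S^a_i=\{d\in A_{k+1}^*\times\cdots\times A_{i-1}^*: ad\in S_i\}$ (so $S^a_{k+1}=\{\epsilon\}$ if $a\in S_{k+1}$ and $\emptyset$ otherwise). -}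

module Defs where

open import Data.Nat using (ℕ; zero; suc; _+_; _∸_; _≤_; _<_)
open import Data.Fin using (Fin; fromℕ<)
open import Data.Maybe using (Maybe; just; nothing)
open import Data.List using (List; []; _∷_; _++_; [_]; length; replicate; take)
open import Data.Bool using (Bool; true; false)
open import Data.Product using (Σ; ∃; ∃-syntax; _×_; _,_)
open import Data.Sum using (_⊎_)
open import Data.Unit using (⊤)
open import Relation.Nullary using (¬_)
open import Relation.Binary.PropositionalEquality using (_≡_; _≢_)
open import Function.Bundles using (_⇔_)

-- An answer is an element of A_i ∪ {*}; * is 'nothing', the answer j is 'just j'.
Ans : Set
Ans = Maybe ℕ

stars : ℕ → List Ans
stars n = replicate n nothing

okEntry : ℕ → Ans → Set
okEntry n nothing  = ⊤
okEntry n (just j) = j < n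

ValidFrom : (N : ℕ) → (Fin N → ℕ) → ℕ → List Ans → Set
ValidFrom N m k []       = ⊤
ValidFrom N m k (x ∷ xs) = Σ (k < N) (λ p → okEntry (m (fromℕ< p)) x) × ValidFrom N m (suc k) xs

-- AStr N m k n s : s is a (k, k+n-1)-answer string (n = 0 : the empty string)
AStr : (N : ℕ) → (Fin N → ℕ) → ℕ → ℕ → List Ans → Set
AStr N m k n s = ValidFrom N m k s × length s ≡ n

-- Sets of answer strings are given by characteristic functions:
--   S q : List Ans → Bool   (S_q),   F : List Ans → Bool   (flag-set).

IsFlagSet : (N : ℕ) → (Fin N → ℕ) → (List Ans → Bool) → Set
IsFlagSet N m F = ∀ f → F f ≡ true → AStr N m 0 N f

-- S = (S_0, …, S_N) is a skip-list (entries S q for q > N are irrelevant)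
IsSkipList : (N : ℕ) → (m : Fin N → ℕ) → (ℕ → List Ans → Bool) → Set
IsSkipList N m S =
    (∀ c → S 0 c ≡ false)
  × (∀ c → S N c ≡ false)
  × (∀ q c → 1 ≤ q → q ≤ N → S q c ≡ true → AStr N m 0 q c)
  × (∀ q (q<N : q < N) c → 1 ≤ q → AStr N m 0 q c →
        (S q c ≡ true → ∀ j → j < m (fromℕ< q<N) → ∀ d → ValidFrom N m (suc q) d →
             S (suc q + length d) (c ++ just j ∷ d) ≡ false)
      × (S q c ≡ false → ∀ d → ValidFrom N m (suc q) d →
             S (suc q + length d) (c ++ nothing ∷ d) ≡ false))

Compatible : (N : ℕ) → (m : Fin N → ℕ) → (ℕ → List Ans → Bool) → (List Ans → Bool) → Set
Compatible N m S F =
  ∀ f → F f ≡ true →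
    Σ ℕ λ ℓ → Σ (ℓ < N) λ ℓ<N → Σ (List Ans) λ p → Σ Ans λ x →
        -- (i)  f = f_0 … f_ℓ * … *   with p = f_0 … f_{ℓ-1}, x = f_ℓ
        (length p ≡ ℓ × f ≡ p ++ x ∷ stars (N ∸ suc ℓ))
      × (∀ u y v → f ≡ u ++ y ∷ v → length u ≤ ℓ → (S (length u) u ≡ true ⇔ y ≡ nothing))
      × (x ≢ nothing → Σ ℕ λ j → j < m (fromℕ< ℓ<N) × F (p ++ just j ∷ stars (N ∸ suc ℓ)) ≡ false)
      × (∀ i → i < ℓ → F (take (suc i) f ++ stars (N ∸ suc i)) ≡ false)

-- The FS-decision tree.  Each vertex is identified with its answer string α(u)
-- (α is injective on T); the question assignment is κ(u) = length α(u).
module FS (N : ℕ) (m : Fin N → ℕ) (S : ℕ → List Ans → Bool) (F : List Ans → Bool) where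

  data Child : List Ans → List Ans → Set where
    skipped : ∀ {c} → length c < N → S (length c) c ≡ true → Child c (c ++ [ nothing ])
    answer  : ∀ {c j} (p : length c < N) → S (length c) c ≡ false → j < m (fromℕ< p) →
              Child c (c ++ [ just j ])

  data Vertex : List Ans → Set where
    root : Vertex []
    step : ∀ {c c'} → Vertex c → Child c c' → Vertex c'

  data InSub (v : List Ans) : List Ans → Set where
    here  : InSub v v
    there : ∀ {u u'} → InSub v u → Child u u' → InSub v u'

  Flagged : List Ans → Set
  Flagged c = Σ (List Ans) λ u → Σ (List Ans) λ t →
                c ≡ u ++ t × 1 ≤ length u × F (u ++ stars (N ∸ length u)) ≡ true

  Equivalent : List Ans → List Ans → Set
  Equivalent v w = Σ (List Ans → List Ans) λ Φ →
      (∀ u → InSub v u → InSub w (Φ u))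
    × (∀ u u' → InSub v u → InSub v u' → Φ u ≡ Φ u' → u ≡ u')
    × (∀ u' → InSub w u' → Σ (List Ans) λ u → InSub v u × Φ u ≡ u')
    × (∀ u x → InSub v u → u ≡ v ++ x → Φ u ≡ w ++ x)
    × (∀ u → InSub v u → (Flagged u ⇔ Flagged (Φ u)))

  LocF : List Ans → List Ans → Set
  LocF a d = (Flagged a × d ≡ stars (N ∸ length a)) ⊎ (¬ Flagged a × F (a ++ d) ≡ true)

  SameLocF : List Ans → List Ans → Set
  SameLocF a b = ∀ d → (LocF a d ⇔ LocF b d)

  -- S^a = S^b for (0,k)-answer strings a, b:  S^a_i = S^b_i for k+1 ≤ i ≤ N, i.e. for every
  -- (k+1,i-1)-answer string d,  a d ∈ S_i ⇔ b d ∈ S_i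
  SameLocS : ℕ → List Ans → List Ans → Set
  SameLocS k a b = ∀ d → ValidFrom N m (suc k) d →
    S (suc k + length d) (a ++ d) ≡ S (suc k + length d) (b ++ d)

-- By (a), an equivalence T_a → T_b can only be the shift a ++ x ↦ b ++ x, so a and b are
-- equivalent iff x ↦ x matches the subtrees below a and b together with their flagged
-- vertices (ShiftEquivalent).  The subtree below a is generated by the values S(a ++ x), and
-- whether a ++ x is flagged can be read off from F^a; so equal local data give equivalence.
-- Conversely, a skipped string a ++ d is always a vertex of T_a, because by the skip-list
-- axioms a string that has left the tree is never skipped; its *-child shifts into T_b, so
-- S^a ⊆ S^b.  By compatibility a flag a ++ d ∈ F above an unflagged a is the first flag on a
-- path of T_a; shifting that path into T_b shows b ++ d ∈ F, so F^a ⊆ F^b.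
module Submission where

open import Defs
open import Data.Nat using (ℕ; suc; _+_; _∸_; _≤_; _<_; z≤n; s≤s)
open import Data.Nat.Properties
  using (+-identityʳ; +-suc; ≤-trans; ≤-pred; ≤∧≢⇒<; ≤-reflexive; 1+n≰n; _≤?_)
open import Data.Fin using (Fin; fromℕ<)
open import Data.Maybe using (just; nothing)
open import Data.List using (List; []; _∷_; _++_; [_]; _∷ʳ_; length; take; drop)
open import Data.List.Properties
  using ( ++-assoc; ++-identityʳ; ++-cancelˡ; length-++; length-++-≤ˡ
        ; ∷-injective; ∷-injectiveˡ; ∷-injectiveʳ; ∷ʳ-injective; ∷ʳ-++)
open import Data.Bool using (Bool; true; false)
open import Data.Bool.Properties using (⇔→≡) renaming (_≟_ to _≟ᵇ_)
open import Data.Product using (Σ; _×_; _,_; proj₁; proj₂)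
open import Data.Sum using (_⊎_; inj₁; inj₂)
open import Data.Unit using (tt)
open import Relation.Nullary using (¬_; Dec; yes; no; contradiction)
open import Relation.Nullary.Decidable using (_×-dec_)
open import Function using (_∘_; id)
open import Relation.Binary.PropositionalEquality
  using (_≡_; _≢_; refl; sym; trans; cong; subst; subst₂; module ≡-Reasoning)
open import Function.Bundles using (_⇔_; mk⇔; Equivalence)
open import Function.Properties.Equivalence using () renaming (sym to ⇔-sym; trans to ⇔-trans)

open Equivalence

module _ {A : Set} where

  ++-levi : ∀ (a x u t : List A) → a ++ x ≡ u ++ t →
            (Σ (List A) λ e → u ≡ a ++ e × x ≡ e ++ t) ⊎
            (Σ A λ y → Σ (List A) λ e → a ≡ u ++ y ∷ e × t ≡ y ∷ e ++ x)
  ++-levi []      x u       t eq = inj₁ (u , refl , eq)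
  ++-levi (z ∷ a) x []      t eq = inj₂ (z , a , refl , sym eq)
  ++-levi (z ∷ a) x (w ∷ u) t eq with ∷-injective eq
  ... | refl , eq′ with ++-levi a x u t eq′
  ...   | inj₁ (e , u≡ , x≡)       = inj₁ (e , cong (z ∷_) u≡ , x≡)
  ...   | inj₂ (y , e , a≡ , t≡)   = inj₂ (y , e , cong (z ∷_) a≡ , t≡)

  length-∷ʳ : ∀ (xs : List A) x → length (xs ∷ʳ x) ≡ suc (length xs)
  length-∷ʳ []       x = refl
  length-∷ʳ (_ ∷ xs) x = cong suc (length-∷ʳ xs x)

  length-++-∷ʳ : ∀ (xs ys : List A) y → length (xs ++ ys ∷ʳ y) ≡ suc (length (xs ++ ys))
  length-++-∷ʳ xs ys y = trans (cong length (sym (++-assoc xs ys [ y ]))) (length-∷ʳ (xs ++ ys) y)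

  length-<-++-∷ : ∀ (xs : List A) y ys → length xs < length (xs ++ y ∷ ys)
  length-<-++-∷ []       y ys = s≤s z≤n
  length-<-++-∷ (_ ∷ xs) y ys = s≤s (length-<-++-∷ xs y ys)

  length-++-≡ : ∀ (xs : List A) {n} ys → length xs ≡ n → length (xs ++ ys) ≡ n + length ys
  length-++-≡ xs ys refl = length-++ xs

  take-length-++ : ∀ (xs ys : List A) → take (length xs) (xs ++ ys) ≡ xs
  take-length-++ []       ys = refl
  take-length-++ (x ∷ xs) ys = cong (x ∷_) (take-length-++ xs ys)

  drop-length-++ : ∀ (xs ys : List A) → drop (length xs) (xs ++ ys) ≡ ys
  drop-length-++ []       ys = refl
  drop-length-++ (x ∷ xs) ys = drop-length-++ xs ys

  HasPrefix : (List A → Set) → List A → Set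
  HasPrefix P c = Σ (List A) λ u → Σ (List A) λ t → c ≡ u ++ t × P u

  hasPrefix? : ∀ {P : List A → Set} → (∀ u → Dec (P u)) → ∀ c → Dec (HasPrefix P c)
  hasPrefix? P? [] with P? []
  ... | yes p = yes ([] , [] , refl , p)
  ... | no ¬p = no λ { ([] , _ , _ , p) → ¬p p ; (_ ∷ _ , _ , () , _) }
  hasPrefix? {P} P? (x ∷ c) with P? [] | hasPrefix? (λ u → P? (x ∷ u)) c
  ... | yes p  | _                      = yes ([] , x ∷ c , refl , p)
  ... | no _   | yes (u , t , c≡ , p)   = yes (x ∷ u , t , cong (x ∷_) c≡ , p)
  ... | no ¬p  | no ¬q                  = no λ
    { ([] , _ , _ , p)           → ¬p p
    ; (y ∷ u , t , x∷c≡ , p)     →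
        ¬q (u , t , ∷-injectiveʳ x∷c≡ , subst (λ z → P (z ∷ u)) (sym (∷-injectiveˡ x∷c≡)) p) }

module FSTree (N : ℕ) (m : Fin N → ℕ) (S : ℕ → List Ans → Bool) (F : List Ans → Bool) where
  open FS N m S F

  Valid : ℕ → List Ans → Set
  Valid = ValidFrom N m

  valid-++⁺ : ∀ k xs ys → Valid k xs → Valid (k + length xs) ys → Valid k (xs ++ ys)
  valid-++⁺ k []       ys _        vys = subst (λ n → Valid n ys) (+-identityʳ k) vys
  valid-++⁺ k (x ∷ xs) ys (vx , vxs) vys =
    vx , valid-++⁺ (suc k) xs ys vxs (subst (λ n → Valid n ys) (+-suc k (length xs)) vys)

  valid-++⁻ : ∀ k xs ys → Valid k (xs ++ ys) → Valid k xs × Valid (k + length xs) ys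
  valid-++⁻ k []       ys v = tt , subst (λ n → Valid n ys) (sym (+-identityʳ k)) v
  valid-++⁻ k (x ∷ xs) ys (vx , v) with valid-++⁻ (suc k) xs ys v
  ... | vxs , vys = (vx , vxs) , subst (λ n → Valid n ys) (sym (+-suc k (length xs))) vys

  isSkipped : List Ans → Bool
  isSkipped c = S (length c) c

  isSkipped-++ : ∀ {a k} d → length a ≡ suc k → isSkipped (a ++ d) ≡ S (suc k + length d) (a ++ d)
  isSkipped-++ {a} d la = cong (λ n → S n (a ++ d)) (length-++-≡ a d la)

  LegalStep : List Ans → Ans → Set
  LegalStep c y = Valid (length c) [ y ] × (isSkipped c ≡ true ⇔ y ≡ nothing)

  child-view : ∀ {c c′} → Child c c′ → Σ Ans λ y → c′ ≡ c ∷ʳ y × LegalStep c y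
  child-view (skipped p s)  = nothing , refl , ((p , tt) , tt) , mk⇔ (λ _ → refl) (λ _ → s)
  child-view (answer p s l) = just _ , refl , ((p , l) , tt) , mk⇔ (λ s′ → contradiction (trans (sym s′) s) λ ()) λ ()

  legal⇒child : ∀ {c y} → LegalStep c y → Child c (c ∷ʳ y)
  legal⇒child {y = nothing} (((p , _) , _) , skip⇔) = skipped p (from skip⇔ refl)
  legal⇒child {c} {just j} (((p , ok) , _) , skip⇔) with isSkipped c in s
  ... | true  = contradiction (to skip⇔ refl) λ ()
  ... | false = answer p s ok

  child⇔legal : ∀ {c y} → Child c (c ∷ʳ y) ⇔ LegalStep c y
  child⇔legal {c} {y} = mk⇔ legal legal⇒child
    where
      legal : Child c (c ∷ʳ y) → LegalStep c y
      legal ch with child-view ch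
      ... | y′ , c∷ʳy≡ , legal′ with ∷ʳ-injective c c c∷ʳy≡
      ...   | _ , refl = legal′

  child-skipped : ∀ {c} → Child c (c ∷ʳ nothing) → isSkipped c ≡ true
  child-skipped ch = from (proj₂ (to child⇔legal ch)) refl

  child-transport : ∀ {c c′ y} → length c ≡ length c′ → isSkipped c ≡ isSkipped c′ →
                    Child c (c ∷ʳ y) → Child c′ (c′ ∷ʳ y)
  child-transport {y = y} |c|≡ s≡ ch with to child⇔legal ch
  ... | vy , skip⇔ = legal⇒child ( subst (λ n → Valid n [ y ]) |c|≡ vy
                                 , subst (λ s → s ≡ true ⇔ y ≡ nothing) s≡ skip⇔)

  InSub-trans : ∀ {u v w} → InSub u v → InSub v w → InSub u w
  InSub-trans iu here          = iu
  InSub-trans iu (there iv ch) = there (InSub-trans iu iv) ch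

  InSub-∷ : ∀ {c y d} → Child c (c ∷ʳ y) → InSub (c ∷ʳ y) (c ∷ʳ y ++ d) → InSub c (c ++ y ∷ d)
  InSub-∷ {c} {y} {d} ch below = subst (InSub c) (∷ʳ-++ c y d) (InSub-trans (there here ch) below)

  InSub⇒++ : ∀ {v u} → InSub v u → Σ (List Ans) λ x → u ≡ v ++ x
  InSub⇒++ {v} here = [] , sym (++-identityʳ v)
  InSub⇒++ {v} (there iu ch) with InSub⇒++ iu | child-view ch
  ... | x , refl | y , refl , _ = x ∷ʳ y , ++-assoc v x [ y ]

  InSub-∷ʳ⁻ : ∀ {v u y} → InSub v (u ∷ʳ y) → length v ≤ length u → InSub v u × Child u (u ∷ʳ y)
  InSub-∷ʳ⁻ = go refl
    where
      go : ∀ {v u y w} → w ≡ u ∷ʳ y → InSub v w → length v ≤ length u → InSub v u × Child u (u ∷ʳ y)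
      go {u = u} {y} refl here v≤u = contradiction (subst (_≤ length u) (length-∷ʳ u y) v≤u) 1+n≰n
      go {u = u} w≡ (there {u′} iu ch) _ with child-view ch
      ... | y′ , refl , _ with ∷ʳ-injective u′ u w≡
      ...   | refl , refl = iu , ch

  InSub-vertex : ∀ {v u} → Vertex v → InSub v u → Vertex u
  InSub-vertex vv here          = vv
  InSub-vertex vv (there iu ch) = step (InSub-vertex vv iu) ch

  vertex-valid : ∀ {c} → Vertex c → Valid 0 c
  vertex-valid root = tt
  vertex-valid (step {c} vc ch) with child-view ch
  ... | y , refl , vy , _ = valid-++⁺ 0 c [ y ] (vertex-valid vc) vy

  vertex-length : ∀ {c} → Vertex c → length c ≤ N
  vertex-length root = z≤n
  vertex-length (step {c} vc ch) with child-view ch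
  ... | y , refl , ((|c|<N , _) , _) , _ = subst (_≤ N) (sym (length-∷ʳ c y)) |c|<N

  ShiftEquivalent : List Ans → List Ans → Set
  ShiftEquivalent a b = ∀ x → (InSub a (a ++ x) ⇔ InSub b (b ++ x))
                            × (InSub a (a ++ x) → Flagged (a ++ x) ⇔ Flagged (b ++ x))

  shiftEquivalent-sym : ∀ {a b} → ShiftEquivalent a b → ShiftEquivalent b a
  shiftEquivalent-sym se x = ⇔-sym (proj₁ (se x)) , λ ib → ⇔-sym (proj₂ (se x) (from (proj₁ (se x)) ib))

  shiftEquivalent⇒flagged⇔ : ∀ {a b} → ShiftEquivalent a b → Flagged a ⇔ Flagged b
  shiftEquivalent⇒flagged⇔ {a} {b} se =
    subst₂ (λ u v → Flagged u ⇔ Flagged v) (++-identityʳ a) (++-identityʳ b)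
           (proj₂ (se []) (subst (InSub a) (sym (++-identityʳ a)) here))

  equivalent⇒shiftEquivalent : ∀ {a b} → Equivalent a b → ShiftEquivalent a b
  equivalent⇒shiftEquivalent {a} {b} (Φ , into , _ , onto , shifts , flags) x =
    mk⇔ forth back , λ ia → subst (λ w → Flagged (a ++ x) ⇔ Flagged w) (shifts _ x ia refl) (flags _ ia)
    where
      forth : InSub a (a ++ x) → InSub b (b ++ x)
      forth ia = subst (InSub b) (shifts _ x ia refl) (into _ ia)
      back : InSub b (b ++ x) → InSub a (a ++ x)
      back ib with onto (b ++ x) ib
      ... | u , iu , Φu≡ with InSub⇒++ iu
      ...   | x′ , refl =
        subst (λ z → InSub a (a ++ z)) (++-cancelˡ b x′ x (trans (sym (shifts _ x′ iu refl)) Φu≡)) iu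

  shiftEquivalent⇒equivalent : ∀ {a b} → ShiftEquivalent a b → Equivalent a b
  shiftEquivalent⇒equivalent {a} {b} se = Φ , into , injective , onto , (λ { _ x _ refl → Φ-++ x }) , flags
    where
      Φ : List Ans → List Ans
      Φ u = b ++ drop (length a) u
      Φ-++ : ∀ x → Φ (a ++ x) ≡ b ++ x
      Φ-++ x = cong (b ++_) (drop-length-++ a x)
      into : ∀ u → InSub a u → InSub b (Φ u)
      into u iu with InSub⇒++ iu
      ... | x , refl = subst (InSub b) (sym (Φ-++ x)) (to (proj₁ (se x)) iu)
      injective : ∀ u u′ → InSub a u → InSub a u′ → Φ u ≡ Φ u′ → u ≡ u′
      injective u u′ iu iu′ Φu≡ with InSub⇒++ iu | InSub⇒++ iu′
      ... | x , refl | x′ , refl = cong (a ++_) (++-cancelˡ b x x′ (trans (sym (Φ-++ x)) (trans Φu≡ (Φ-++ x′))))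
      onto : ∀ u′ → InSub b u′ → Σ (List Ans) λ u → InSub a u × Φ u ≡ u′
      onto u′ ib with InSub⇒++ ib
      ... | x , refl = a ++ x , from (proj₁ (se x)) ib , Φ-++ x
      flags : ∀ u → InSub a u → Flagged u ⇔ Flagged (Φ u)
      flags u iu with InSub⇒++ iu
      ... | x , refl = subst (λ w → Flagged (a ++ x) ⇔ Flagged w) (sym (Φ-++ x)) (proj₂ (se x) iu)

  equivalent⇔shiftEquivalent : ∀ {a b} → Equivalent a b ⇔ ShiftEquivalent a b
  equivalent⇔shiftEquivalent = mk⇔ equivalent⇒shiftEquivalent shiftEquivalent⇒equivalent

  descendant-shift : ∀ {a b k} → Vertex a → length a ≡ suc k → length b ≡ suc k → SameLocS k a b →
                     ∀ x → InSub a (a ++ x) → InSub b (b ++ x)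
  descendant-shift {a} {b} va la lb sameS x ia =
    let x′ , a++x≡ , ib = transport ia in subst (λ z → InSub b (b ++ z)) (sym (++-cancelˡ a x x′ a++x≡)) ib
    where
      transport : ∀ {u} → InSub a u → Σ (List Ans) λ x → u ≡ a ++ x × InSub b (b ++ x)
      transport here = [] , sym (++-identityʳ a) , subst (InSub b) (sym (++-identityʳ b)) here
      transport (there iu ch) with transport iu
      ... | x , refl , ib with child-view ch
      ...   | y , refl , _ =
        x ∷ʳ y , ++-assoc a x [ y ]
               , subst (InSub b) (++-assoc b x [ y ]) (there ib (child-transport |a++x|≡ skip≡ ch))
        where
          |a++x|≡ : length (a ++ x) ≡ length (b ++ x)
          |a++x|≡ = trans (length-++-≡ a x la) (sym (length-++-≡ b x lb))
          vx : Valid (suc _) x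
          vx = subst (λ n → Valid n x) la (proj₂ (valid-++⁻ 0 a x (vertex-valid (InSub-vertex va iu))))
          skip≡ : isSkipped (a ++ x) ≡ isSkipped (b ++ x)
          skip≡ = trans (isSkipped-++ x la) (trans (sameS x vx) (sym (isSkipped-++ x lb)))

  module _ (skipList : IsSkipList N m S) where

    skipList-at : ∀ {c} → Vertex c → 1 ≤ length c → (|c|<N : length c < N) →
                   (isSkipped c ≡ true → ∀ j → j < m (fromℕ< |c|<N) → ∀ d → Valid (suc (length c)) d →
                      isSkipped (c ++ just j ∷ d) ≡ false)
                 × (isSkipped c ≡ false → ∀ d → Valid (suc (length c)) d → isSkipped (c ++ nothing ∷ d) ≡ false)
    skipList-at {c} vc 1≤ |c|<N with proj₂ (proj₂ (proj₂ skipList)) (length c) |c|<N c 1≤ (vertex-valid vc , refl)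
    ... | answered , starred =
      (λ s j j< d vd → unskipped (answered s j j< d vd)) , (λ s d vd → unskipped (starred s d vd))
      where
        unskipped : ∀ {y d} → S (suc (length c) + length d) (c ++ y ∷ d) ≡ false → isSkipped (c ++ y ∷ d) ≡ false
        unskipped {y} {d} =
          subst (λ n → S n (c ++ y ∷ d) ≡ false) (sym (trans (length-++ c) (+-suc (length c) (length d))))

    child-or-unskipped : ∀ {c} → Vertex c → 1 ≤ length c → ∀ y d → Valid (length c) (y ∷ d) →
                         Child c (c ∷ʳ y) ⊎ isSkipped (c ++ y ∷ d) ≡ false
    child-or-unskipped {c} vc 1≤ nothing d ((|c|<N , _) , vd) with isSkipped c in s
    ... | true  = inj₁ (skipped |c|<N s)
    ... | false = inj₂ (proj₂ (skipList-at vc 1≤ |c|<N) s d vd)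
    child-or-unskipped {c} vc 1≤ (just j) d ((|c|<N , j<) , vd) with isSkipped c in s
    ... | false = inj₁ (answer |c|<N s j<)
    ... | true  = inj₂ (proj₁ (skipList-at vc 1≤ |c|<N) s j j< d vd)

    descendant-or-unskipped : ∀ {c} → Vertex c → 1 ≤ length c → ∀ d → Valid (length c) d →
                              InSub c (c ++ d) ⊎ isSkipped (c ++ d) ≡ false
    descendant-or-unskipped {c} vc 1≤ [] _ = inj₁ (subst (InSub c) (sym (++-identityʳ c)) here)
    descendant-or-unskipped {c} vc 1≤ (y ∷ d) vyd@(_ , vd) with child-or-unskipped vc 1≤ y d vyd
    ... | inj₂ off = inj₂ off
    ... | inj₁ ch with descendant-or-unskipped (step vc ch) (≤-trans 1≤ (length-++-≤ˡ c)) d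
                         (subst (λ n → Valid n d) (sym (length-∷ʳ c y)) vd)
    ...   | inj₁ below = inj₁ (InSub-∷ ch below)
    ...   | inj₂ off   = inj₂ (subst (λ w → isSkipped w ≡ false) (∷ʳ-++ c y d) off)

    skipped-child : ∀ {c} → Vertex c → isSkipped c ≡ true → Child c (c ∷ʳ nothing)
    skipped-child {c} vc s = skipped (≤∧≢⇒< (vertex-length vc) |c|≢N) s
      where
        |c|≢N : length c ≢ N
        |c|≢N |c|≡N =
          contradiction (trans (sym s) (subst (λ n → S n c ≡ false) (sym |c|≡N) (proj₁ (proj₂ skipList) c))) λ ()

    skipped-transport : ∀ {a b k} → Vertex a → length a ≡ suc k → (∀ x → InSub a (a ++ x) → InSub b (b ++ x)) →
                        ∀ d → Valid (suc k) d → isSkipped (a ++ d) ≡ true → isSkipped (b ++ d) ≡ true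
    skipped-transport {a} {b} va la shift d vd s
      with descendant-or-unskipped va (subst (1 ≤_) (sym la) (s≤s z≤n)) d (subst (λ n → Valid n d) (sym la) vd)
    ... | inj₂ off   = contradiction (trans (sym s) off) λ ()
    ... | inj₁ below = child-skipped (proj₂ (InSub-∷ʳ⁻ b-below (length-++-≤ˡ b)))
      where
        a-below : InSub a (a ++ (d ∷ʳ nothing))
        a-below = subst (InSub a) (++-assoc a d [ nothing ]) (there below (skipped-child (InSub-vertex va below) s))
        b-below : InSub b ((b ++ d) ∷ʳ nothing)
        b-below = subst (InSub b) (sym (++-assoc b d [ nothing ])) (shift (d ∷ʳ nothing) a-below)

    shiftEquivalent⇒sameLocS : ∀ {a b k} → Vertex a → Vertex b → length a ≡ suc k → length b ≡ suc k →
                               ShiftEquivalent a b → SameLocS k a b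
    shiftEquivalent⇒sameLocS {a} {b} {k} va vb la lb se d vd = begin
      S (suc k + length d) (a ++ d)  ≡⟨ isSkipped-++ d la ⟨
      isSkipped (a ++ d)             ≡⟨ ⇔→≡ (mk⇔ (skipped-transport va la (λ x → to (proj₁ (se x))) d vd)
                                                 (skipped-transport vb lb (λ x → from (proj₁ (se x))) d vd)) ⟩
      isSkipped (b ++ d)             ≡⟨ isSkipped-++ d lb ⟩
      S (suc k + length d) (b ++ d)  ∎
      where open ≡-Reasoning

  Flag : List Ans → Set
  Flag u = F (u ++ stars (N ∸ length u)) ≡ true

  flagged? : ∀ c → Dec (Flagged c)
  flagged? = hasPrefix? (λ u → (1 ≤? length u) ×-dec (F (u ++ stars (N ∸ length u)) ≟ᵇ true))

  flag⇒flagged : ∀ {u} → 1 ≤ length u → Flag u → Flagged u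
  flag⇒flagged {u} 1≤ fl = u , [] , sym (++-identityʳ u) , 1≤ , fl

  flagged-++ : ∀ {c} x → Flagged c → Flagged (c ++ x)
  flagged-++ x (u , t , refl , 1≤ , fl) = u , t ++ x , ++-assoc u t x , 1≤ , fl

  flagged-∷ʳ⁻ : ∀ {w y} → Flagged (w ∷ʳ y) → Flagged w ⊎ Flag (w ∷ʳ y)
  flagged-∷ʳ⁻ {w} {y} (u , t , eq , 1≤ , fl) with ++-levi w [ y ] u t eq
  ... | inj₂ (z , e , w≡ , _)       = inj₁ (u , z ∷ e , w≡ , 1≤ , fl)
  ... | inj₁ ([] , refl , _)        = inj₁ (subst Flagged (++-identityʳ w) (flag⇒flagged 1≤ fl))
  ... | inj₁ (_ ∷ [] , refl , refl) = inj₂ fl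
  ... | inj₁ (_ ∷ _ ∷ _ , _ , ())

  flagged-++⁻ : ∀ {a x} → ¬ Flagged a → Flagged (a ++ x) →
                Σ (List Ans) λ e → Σ (List Ans) λ t → x ≡ e ++ t × Flag (a ++ e)
  flagged-++⁻ {a} {x} ¬fa (u , t , eq , 1≤ , fl) with ++-levi a x u t eq
  ... | inj₂ (y , e , a≡ , _) = contradiction (u , y ∷ e , a≡ , 1≤ , fl) ¬fa
  ... | inj₁ (e , refl , x≡)  = e , t , x≡ , fl

  flag-++⇒flagged : ∀ {a x e t} → 1 ≤ length a → x ≡ e ++ t → Flag (a ++ e) → Flagged (a ++ x)
  flag-++⇒flagged {a} {e = e} {t} 1≤ refl fl = a ++ e , t , sym (++-assoc a e t) , ≤-trans 1≤ (length-++-≤ˡ a) , fl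

  flag-++⇔ : ∀ a b g → length a ≡ length b → Flag (b ++ g) ⇔ F (b ++ g ++ stars (N ∸ length (a ++ g))) ≡ true
  flag-++⇔ a b g |a|≡|b| =
    subst (λ n → Flag (b ++ g) ⇔ F (b ++ g ++ stars (N ∸ n)) ≡ true) |b++g|≡|a++g|
          (subst (λ w → Flag (b ++ g) ⇔ F w ≡ true) (++-assoc b g _) (mk⇔ id id))
    where
      |b++g|≡|a++g| : length (b ++ g) ≡ length (a ++ g)
      |b++g|≡|a++g| = trans (length-++ b) (trans (cong (_+ length g) (sym |a|≡|b|)) (sym (length-++ a)))

  flagged-transport : ∀ {a b} → length a ≡ length b → 1 ≤ length b → (∀ d → LocF a d → LocF b d) →
                      Flagged a → Flagged b
  flagged-transport {a} {b} |a|≡|b| 1≤ loc fa with loc (stars (N ∸ length a)) (inj₁ (fa , refl))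
  ... | inj₁ (fb , _) = fb
  ... | inj₂ (_ , fl) = flag⇒flagged 1≤ (subst (λ n → F (b ++ stars (N ∸ n)) ≡ true) |a|≡|b| fl)

  flagged-++-transport : ∀ {a b} → length a ≡ length b → 1 ≤ length b → (∀ d → LocF a d → LocF b d) →
                         ∀ x → Flagged (a ++ x) → Flagged (b ++ x)
  flagged-++-transport {a} {b} |a|≡|b| 1≤ loc x fax with flagged? a
  ... | yes fa = flagged-++ x (flagged-transport |a|≡|b| 1≤ loc fa)
  ... | no ¬fa with flagged-++⁻ ¬fa fax
  ...   | e , t , x≡ , fl with loc (e ++ stars (N ∸ length (a ++ e))) (inj₂ (¬fa , to (flag-++⇔ a a e refl) fl))
  ...     | inj₁ (fb , _)  = flagged-++ x fb
  ...     | inj₂ (_ , fl′) = flag-++⇒flagged 1≤ x≡ (from (flag-++⇔ a b e |a|≡|b|) fl′)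

  SkipConsistentUpTo : ℕ → List Ans → Set
  SkipConsistentUpTo ℓ f = ∀ u y v → f ≡ u ++ y ∷ v → length u ≤ ℓ → (isSkipped u ≡ true ⇔ y ≡ nothing)

  NoFlagBefore : ℕ → List Ans → Set
  NoFlagBefore ℓ f = ∀ i → i < ℓ → F (take (suc i) f ++ stars (N ∸ suc i)) ≡ false

  skipConsistent⇒descendant : ∀ {f ℓ} → Valid 0 f → SkipConsistentUpTo ℓ f →
                              ∀ c e {r} → f ≡ c ++ e ++ r → length (c ++ e) ≤ suc ℓ → InSub c (c ++ e)
  skipConsistent⇒descendant vf sc c [] _ _ = subst (InSub c) (sym (++-identityʳ c)) here
  skipConsistent⇒descendant {f} {ℓ} vf sc c (y ∷ e) {r} f≡ bound =
    InSub-∷ (legal⇒child (vy , sc c y (e ++ r) f≡ |c|≤ℓ)) (skipConsistent⇒descendant vf sc (c ∷ʳ y) e f≡′ bound′)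
    where
      |c|≤ℓ : length c ≤ ℓ
      |c|≤ℓ = ≤-pred (≤-trans (length-<-++-∷ c y e) bound)
      vy : Valid (length c) [ y ]
      vy = proj₁ (proj₂ (valid-++⁻ 0 c (y ∷ e ++ r) (subst (Valid 0) f≡ vf))) , tt
      f≡′ : f ≡ c ∷ʳ y ++ e ++ r
      f≡′ = trans f≡ (sym (∷ʳ-++ c y (e ++ r)))
      bound′ : length (c ∷ʳ y ++ e) ≤ suc ℓ
      bound′ = subst (_≤ suc ℓ) (cong length (sym (∷ʳ-++ c y e))) bound

  noFlagBefore⇒¬flagged : ∀ {f p r} → NoFlagBefore (length p) f → f ≡ p ++ r → ¬ Flagged p
  noFlagBefore⇒¬flagged _ _ ([] , _ , _ , () , _)
  noFlagBefore⇒¬flagged {r = r} noFlag refl (y ∷ w , t , refl , _ , fl) =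
    contradiction (trans (sym fl) (subst (λ z → F (z ++ stars (N ∸ suc (length w))) ≡ false) take≡
                                         (noFlag (length w) (length-++-≤ˡ (y ∷ w))))) λ ()
    where
      take≡ : take (suc (length w)) ((y ∷ w ++ t) ++ r) ≡ y ∷ w
      take≡ = trans (cong (take (suc (length w))) (++-assoc (y ∷ w) t r)) (take-length-++ (y ∷ w) (t ++ r))

  padded-∷ʳ : ∀ c e x → e ++ x ∷ stars (N ∸ suc (length (c ++ e))) ≡ e ∷ʳ x ++ stars (N ∸ length (c ++ e ∷ʳ x))
  padded-∷ʳ c e x = trans (sym (∷ʳ-++ e x _)) (cong (λ n → e ∷ʳ x ++ stars (N ∸ n)) (sym (length-++-∷ʳ c e x)))

  first-flag-below : ∀ {a d} → IsFlagSet N m F → Compatible N m S F → ¬ Flagged a → F (a ++ d) ≡ true →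
              Σ (List Ans) λ e → Σ Ans λ x →
                d ≡ e ∷ʳ x ++ stars (N ∸ length (a ++ e ∷ʳ x)) × InSub a (a ++ e ∷ʳ x) × ¬ Flagged (a ++ e)
  first-flag-below {a} {d} flagSet compatible ¬fa fl with compatible (a ++ d) fl
  ... | _ , _ , p , x , (refl , f≡) , sc , _ , noFlag with ++-levi a d p (x ∷ stars (N ∸ suc (length p))) f≡
  ...   | inj₁ (e , refl , d≡) = e , x , d≡′ , below , noFlagBefore⇒¬flagged noFlag f≡
    where
      d≡′ : d ≡ e ∷ʳ x ++ stars (N ∸ length (a ++ e ∷ʳ x))
      d≡′ = trans d≡ (padded-∷ʳ a e x)
      below : InSub a (a ++ e ∷ʳ x)
      below = skipConsistent⇒descendant (proj₁ (flagSet _ fl)) sc a (e ∷ʳ x) (cong (a ++_) d≡′)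
                                        (≤-reflexive (length-++-∷ʳ a e x))
  ...   | inj₂ (y , e , a≡ , t≡) with ∷-injective t≡
  ...     | refl , _ = contradiction ( p ∷ʳ x , e , trans a≡ (sym (∷ʳ-++ p x e))
                                     , subst (1 ≤_) (sym (length-∷ʳ p x)) (s≤s z≤n)
                                     , subst (λ w → F w ≡ true) (trans f≡ (padded-∷ʳ [] p x)) fl) ¬fa

  locF-transport : ∀ {a b} → IsFlagSet N m F → Compatible N m S F → length a ≡ length b →
                   ShiftEquivalent a b → ∀ d → LocF a d → LocF b d
  locF-transport _ _ |a|≡|b| se d (inj₁ (fa , refl)) =
    inj₁ (to (shiftEquivalent⇒flagged⇔ se) fa , cong (λ n → stars (N ∸ n)) |a|≡|b|)
  locF-transport {a} {b} flagSet compatible |a|≡|b| se d (inj₂ (¬fa , fl))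
    with first-flag-below flagSet compatible ¬fa fl
  ... | e , x , refl , below , ¬fae =
    inj₂ (¬fa ∘ from (shiftEquivalent⇒flagged⇔ se) , to (flag-++⇔ a b (e ∷ʳ x) |a|≡|b|) flag-b)
    where
      flagged-b : Flagged (b ++ e ∷ʳ x)
      flagged-b = to (proj₂ (se (e ∷ʳ x)) below)
                     (flag⇒flagged (subst (1 ≤_) (sym (length-++-∷ʳ a e x)) (s≤s z≤n))
                                   (from (flag-++⇔ a a (e ∷ʳ x) refl) fl))
      a-below : InSub a (a ++ e)
      a-below = proj₁ (InSub-∷ʳ⁻ (subst (InSub a) (sym (++-assoc a e [ x ])) below) (length-++-≤ˡ a))
      ¬fbe : ¬ Flagged (b ++ e)
      ¬fbe = ¬fae ∘ from (proj₂ (se e) a-below)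
      flag-b : Flag (b ++ e ∷ʳ x)
      flag-b with flagged-∷ʳ⁻ (subst Flagged (sym (++-assoc b e [ x ])) flagged-b)
      ... | inj₁ fbe = contradiction fbe ¬fbe
      ... | inj₂ fl′ = subst Flag (++-assoc b e [ x ]) fl′

  shiftEquivalent⇒sameLocF : ∀ {a b} → IsFlagSet N m F → Compatible N m S F → length a ≡ length b →
                             ShiftEquivalent a b → SameLocF a b
  shiftEquivalent⇒sameLocF flagSet compatible |a|≡|b| se d =
    mk⇔ (locF-transport flagSet compatible |a|≡|b| se d)
        (locF-transport flagSet compatible (sym |a|≡|b|) (shiftEquivalent-sym se) d)

  sameLoc⇒shiftEquivalent : ∀ {a b k} → Vertex a → Vertex b → length a ≡ suc k → length b ≡ suc k →
                            SameLocF a b → SameLocS k a b → ShiftEquivalent a b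
  sameLoc⇒shiftEquivalent {a} {b} va vb la lb sameF sameS x =
      mk⇔ (descendant-shift va la lb sameS x) (descendant-shift vb lb la (λ d vd → sym (sameS d vd)) x)
    , λ _ → mk⇔ (flagged-++-transport |a|≡|b| (subst (1 ≤_) (sym lb) (s≤s z≤n)) (λ d → to (sameF d)) x)
                (flagged-++-transport (sym |a|≡|b|) (subst (1 ≤_) (sym la) (s≤s z≤n)) (λ d → from (sameF d)) x)
    where
      |a|≡|b| : length a ≡ length b
      |a|≡|b| = trans la (sym lb)

  shiftEquivalent⇔sameLoc : ∀ {a b k} → IsSkipList N m S → IsFlagSet N m F → Compatible N m S F →
                            Vertex a → Vertex b → length a ≡ suc k → length b ≡ suc k →
                            ShiftEquivalent a b ⇔ (SameLocF a b × SameLocS k a b)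
  shiftEquivalent⇔sameLoc skipList flagSet compatible va vb la lb = mk⇔
    (λ se → shiftEquivalent⇒sameLocF flagSet compatible (trans la (sym lb)) se
          , shiftEquivalent⇒sameLocS skipList va vb la lb se)
    (λ (sameF , sameS) → sameLoc⇒shiftEquivalent va vb la lb sameF sameS)

theorem4p18 : (N : ℕ) (m : Fin N → ℕ) (S : ℕ → List Ans → Bool) (F : List Ans → Bool) →
    (∀ q → 2 ≤ m q) → IsSkipList N m S → IsFlagSet N m F → Compatible N m S F →
    (k : ℕ) (a b : List Ans) →
    FS.Vertex N m S F a → FS.Vertex N m S F b → length a ≡ suc k → length b ≡ suc k →
    (FS.Equivalent N m S F a b ⇔ (FS.SameLocF N m S F a b × FS.SameLocS N m S F k a b))
theorem4p18 N m S F _ skipList flagSet compatible k a b va vb la lb =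
  ⇔-trans equivalent⇔shiftEquivalent (shiftEquivalent⇔sameLoc skipList flagSet compatible va vb la lb)
  where open FSTree N m S F
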